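{- For any OPS instance $\mathcal P_o=(P,R,g)$ with integer growth rates, the poly density satisfies $\bar h^*\le\frac32 G^*$, where $G^*=\max_{v\in P}\sum_{e\in R:\,v\in e} g(e)$.
   Context: An OPS instance $(P,R,g)$ consists of a finite simple undirected graph $(P,R)$ with growth rates $g:R\to\mathbb R_{>0}$. Let $\mathcal M$ be the set of inclusion-maximal matchings of $(P,R)$. The poly density $\bar h^*$ is the optimal value of: minimise $\bar h$ subject to $\sum_{M\in\mathcal M} y_M\le1$, $g(e)/\sum_{M\in\mathcal M:\,e\in M} y_M\le\bar h$ for all $e\in R$, and $y_M\in[0,1]$ for all $M$. -}

module Defs where

open import Data.Nat as ℕ using (ℕ; _⊔_)
open import Data.Integer using (+_)
open import Data.Fin using (Fin; _≟_)
open import Data.Fin.Subset using (Subset; _∈_; _⊆_; inside)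
open import Data.Vec using (lookup)
open import Data.Bool using (Bool; true; false; if_then_else_; _∨_)
open import Data.List using (List; map; foldr; allFin)
open import Data.Product using (_×_; _,_; proj₁; proj₂)
open import Data.Rational using (ℚ; _+_; _*_; 0ℚ; _/_)
open import Relation.Nullary using (¬_; does)
open import Relation.Binary.PropositionalEquality using (_≡_; _≢_)

record SimpleGraph : Set where
  field
    n : ℕ
    m : ℕ
    ends : Fin m → Fin n × Fin n
    loopless : ∀ e → proj₁ (ends e) ≢ proj₂ (ends e)
    noMulti : ∀ e f → proj₁ (ends e) ≡ proj₁ (ends f) → proj₂ (ends e) ≡ proj₂ (ends f) → e ≡ f
    noMultiSwap : ∀ e f → proj₁ (ends e) ≡ proj₂ (ends f) → proj₂ (ends e) ≡ proj₁ (ends f) → e ≡ f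
open SimpleGraph public

incident : (G : SimpleGraph) → Fin (n G) → Fin (m G) → Bool
incident G v e = does (proj₁ (ends G e) ≟ v) ∨ does (proj₂ (ends G e) ≟ v)

ShareEndpoint : (G : SimpleGraph) → Fin (m G) → Fin (m G) → Set
ShareEndpoint G e f =
  (proj₁ (ends G e) ≡ proj₁ (ends G f)) ⊎' (proj₁ (ends G e) ≡ proj₂ (ends G f))
  ⊎' (proj₂ (ends G e) ≡ proj₁ (ends G f)) ⊎' (proj₂ (ends G e) ≡ proj₂ (ends G f))
  where open import Data.Sum renaming (_⊎_ to _⊎'_)

IsMatching : (G : SimpleGraph) → Subset (m G) → Set
IsMatching G M = ∀ e f → e ∈ M → f ∈ M → e ≢ f → ¬ ShareEndpoint G e f

IsMaximalMatching : (G : SimpleGraph) → Subset (m G) → Set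
IsMaximalMatching G M = IsMatching G M × (∀ M' → IsMatching G M' → M ⊆ M' → M' ⊆ M)

record OPS : Set where
  field
    graph : SimpleGraph
    g : Fin (m graph) → ℕ
    g-pos : ∀ e → 0 ℕ.< g e
open OPS public

sumℕ : List ℕ → ℕ
sumℕ = foldr ℕ._+_ 0

sumℚ : List ℚ → ℚ
sumℚ = foldr _+_ 0ℚ

weightedDegree : (I : OPS) → Fin (n (graph I)) → ℕ
weightedDegree I v =
  sumℕ (map (λ e → if incident (graph I) v e then g I e else 0) (allFin (m (graph I))))

-- G* = max_{v ∈ P} weightedDegree v  (0 if P is empty)
Gstar : (I : OPS) → ℕ
Gstar I = foldr _⊔_ 0 (map (weightedDegree I) (allFin (n (graph I))))

ℕtoℚ : ℕ → ℚ
ℕtoℚ k = + k / 1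

-- A (finitely supported) assignment y : 𝓜 → [0,1] is given as a list of
-- pairs (M , y_M); duplicate entries for the same M are summed.
Assignment : OPS → Set
Assignment I = List (Subset (m (graph I)) × ℚ)

totalWeight : (I : OPS) → Assignment I → ℚ
totalWeight I y = sumℚ (map proj₂ y)

coverage : (I : OPS) → Assignment I → Fin (m (graph I)) → ℚ
coverage I y e = sumℚ (map (λ p → if lookup (proj₁ p) e then proj₂ p else 0ℚ) y)

-- Shannon's theorem does the work: a loopless multigraph of maximum degree D has a proper edge
-- colouring with k = D + ⌊D/2⌋ = ⌊3D/2⌋ colours. Colour the multigraph in which the edge e has
-- multiplicity g(e), extend every colour class greedily to a maximal matching and give it weight
-- 1/k. The weights sum to 1 and e lies in at least g(e) classes, so g(e) / Σ_{M ∋ e} y_M ≤ k ≤ (3/2) G*.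
-- The colouring is built one edge copy xy at a time. If no colour is missing at both x and y, take
-- colours α missing at x and β missing at y; α has an edge yz. The copy fits into α once yz is moved
-- to a colour missing at y and z. If there is none but some γ misses z and x, swapping γ and β along
-- the Kempe path from z makes β miss y and z, or else makes γ miss x and y. Otherwise every colour
-- is present at two of x, y, z, which needs 2k colour slots, but only (D − 1) + (D − 1) + D < 2k exist.

module Submission where

open import Defs
open import Data.Fin.Base using (Fin)
open import Data.Nat.Base as ℕ using (ℕ)

module Sums where

  open import Data.Bool.Base using (Bool; true; false; if_then_else_)
  open import Data.Fin.Base using (zero; suc)
  open import Data.Fin.Properties using (punchInᵢ≢i)
  open import Data.Nat.Base using (zero; suc; _+_; _*_; _≤_; _<_; z≤n)
  open import Data.Nat.Properties
    using ( +-*-semiring; ≤-refl; ≤-reflexive; ≤-trans; *-zeroʳ; *-identityʳ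
          ; +-mono-≤; +-mono-<-≤; +-mono-≤-<; m≤m+n; m≤n+m)
  open import Algebra.Properties.Semiring.Sum +-*-semiring public
    using (sum; sum-syntax; sum-cong-≗; ∑-distrib-+; ∑-comm; *-distribʳ-sum)
  open import Algebra.Properties.Semiring.Sum +-*-semiring using (sum-remove)
  open import Data.Nat.Tactic.RingSolver using (solve-∀)
  open import Data.Vec.Functional using (removeAt)
  open import Function.Base using (_∘_)
  open import Relation.Binary.PropositionalEquality
  open ≡-Reasoning

  toℕ : Bool → ℕ
  toℕ false = 0
  toℕ true  = 1

  toℕ-mono : ∀ {a b} → (a ≡ true → b ≡ true) → toℕ a ≤ toℕ b
  toℕ-mono {false} _   = z≤n
  toℕ-mono {true}  a⇒b rewrite a⇒b refl = ≤-refl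

  scaled-≤ : ∀ {a c} b → a ≤ c → a * toℕ b ≤ (if b then c else 0)
  scaled-≤ {a} false _   = ≤-reflexive (*-zeroʳ a)
  scaled-≤ {a} true  a≤c = ≤-trans (≤-reflexive (*-identityʳ a)) a≤c

  sum-mono-≤ : ∀ {n} {F G : Fin n → ℕ} → (∀ i → F i ≤ G i) → sum F ≤ sum G
  sum-mono-≤ {zero}  F≤G = z≤n
  sum-mono-≤ {suc n} F≤G = +-mono-≤ (F≤G zero) (sum-mono-≤ (F≤G ∘ suc))

  sum-mono-<-at : ∀ {n} {F G : Fin n → ℕ} → (∀ i → F i ≤ G i) → ∀ p → F p < G p → sum F < sum G
  sum-mono-<-at F≤G zero    Fp<Gp = +-mono-<-≤ Fp<Gp (sum-mono-≤ (F≤G ∘ suc))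
  sum-mono-<-at F≤G (suc p) Fp<Gp = +-mono-≤-< (F≤G zero) (sum-mono-<-at (F≤G ∘ suc) p Fp<Gp)

  ≤-sum : ∀ {n} (F : Fin n → ℕ) i → F i ≤ sum F
  ≤-sum F zero    = m≤m+n _ _
  ≤-sum F (suc i) = ≤-trans (≤-sum (F ∘ suc) i) (m≤n+m _ _)

  sum-const : ∀ {n} c → sum {n} (λ _ → c) ≡ n * c
  sum-const {zero}  c = refl
  sum-const {suc n} c = cong (c +_) (sum-const {n} c)

  sum-exchange : ∀ {n} {F G : Fin n → ℕ} i → (∀ j → j ≢ i → G j ≡ F j) → sum G + F i ≡ sum F + G i
  sum-exchange {suc n} {F} {G} i agree = begin
    sum G + F i                     ≡⟨ cong (_+ F i) (sum-remove {i = i} G) ⟩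
    G i + sum (removeAt G i) + F i  ≡⟨ cong (λ s → G i + s + F i) (sum-cong-≗ (λ j → agree _ (punchInᵢ≢i i j))) ⟩
    G i + sum (removeAt F i) + F i  ≡⟨ swap-ends (G i) _ (F i) ⟩
    F i + sum (removeAt F i) + G i  ≡⟨ cong (_+ G i) (sum-remove {i = i} F) ⟨
    sum F + G i                     ∎
    where
    swap-ends : ∀ a s b → a + s + b ≡ b + s + a
    swap-ends = solve-∀

open Sums

module Multisets where

  open import Data.Fin.Base using (zero; suc)
  open import Data.Fin.Properties using (_≟_)
  open import Data.List.Base using (List; []; _∷_; _++_; map; replicate)
  open import Data.Nat.Base using (zero; suc; _+_; _*_)
  open import Data.Nat.Properties using (+-assoc; +-identityʳ; *-identityʳ; *-zeroʳ)
  open import Function.Base using (_∘_)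
  open import Relation.Binary.PropositionalEquality
  open import Relation.Nullary using (does)
  open ≡-Reasoning

  occurrences : ∀ {n} → Fin n → List (Fin n) → ℕ
  occurrences i []      = 0
  occurrences i (j ∷ L) = toℕ (does (i ≟ j)) + occurrences i L

  occurrences-++ : ∀ {n} (i : Fin n) xs ys → occurrences i (xs ++ ys) ≡ occurrences i xs + occurrences i ys
  occurrences-++ i []       ys = refl
  occurrences-++ i (j ∷ xs) ys = trans (cong (toℕ (does (i ≟ j)) +_) (occurrences-++ i xs ys))
    (sym (+-assoc (toℕ (does (i ≟ j))) (occurrences i xs) (occurrences i ys)))

  occurrences-replicate : ∀ {n} (i j : Fin n) r → occurrences i (replicate r j) ≡ r * toℕ (does (i ≟ j))
  occurrences-replicate i j zero    = refl
  occurrences-replicate i j (suc r) = cong (toℕ (does (i ≟ j)) +_) (occurrences-replicate i j r)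

  occurrences-zero-map-suc : ∀ {n} (L : List (Fin n)) → occurrences zero (map suc L) ≡ 0
  occurrences-zero-map-suc []      = refl
  occurrences-zero-map-suc (_ ∷ L) = occurrences-zero-map-suc L

  occurrences-suc-map-suc : ∀ {n} (i : Fin n) L → occurrences (suc i) (map suc L) ≡ occurrences i L
  occurrences-suc-map-suc i []      = refl
  occurrences-suc-map-suc i (j ∷ L) = cong (toℕ (does (i ≟ j)) +_) (occurrences-suc-map-suc i L)

  copies : ∀ {n} → (Fin n → ℕ) → List (Fin n)
  copies {zero}  t = []
  copies {suc n} t = replicate (t zero) zero ++ map suc (copies (t ∘ suc))

  occurrences-copies : ∀ {n} (t : Fin n → ℕ) i → occurrences i (copies t) ≡ t i
  occurrences-copies {suc n} t zero = begin
    occurrences zero (reps ++ rest)                ≡⟨ occurrences-++ zero reps rest ⟩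
    occurrences zero reps + occurrences zero rest  ≡⟨ cong₂ _+_ (occurrences-replicate zero zero (t zero))
                                                                (occurrences-zero-map-suc (copies (t ∘ suc))) ⟩
    t zero * 1 + 0                                 ≡⟨ trans (+-identityʳ _) (*-identityʳ _) ⟩
    t zero                                         ∎
    where
    reps = replicate (t zero) zero
    rest = map suc (copies (t ∘ suc))
  occurrences-copies {suc n} t (suc i) = begin
    occurrences (suc i) (reps ++ rest)                   ≡⟨ occurrences-++ (suc i) reps rest ⟩
    occurrences (suc i) reps + occurrences (suc i) rest  ≡⟨ cong₂ _+_ (occurrences-replicate (suc i) zero (t zero))
                                                                      (occurrences-suc-map-suc i (copies (t ∘ suc))) ⟩
    t zero * 0 + occurrences i (copies (t ∘ suc))        ≡⟨ cong (_+ occurrences i (copies (t ∘ suc))) (*-zeroʳ (t zero)) ⟩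
    occurrences i (copies (t ∘ suc))                     ≡⟨ occurrences-copies (t ∘ suc) i ⟩
    t (suc i)                                            ∎
    where
    reps = replicate (t zero) zero
    rest = map suc (copies (t ∘ suc))

open Multisets

module ColourCount where

  open import Data.Nat.Base using (suc; _+_; _*_; _≤_; ⌊_/2⌋; ⌈_/2⌉)
  open import Data.Nat.Properties
    using (m≤m+n; n≤1+n; +-monoʳ-≤; ⌊n/2⌋-mono; ⌊n/2⌋≤⌈n/2⌉; ⌊n/2⌋+⌈n/2⌉≡n; module ≤-Reasoning)
  open import Data.Nat.Tactic.RingSolver using (solve-∀)
  open import Relation.Binary.PropositionalEquality
  open ≤-Reasoning

  shannonColours : ℕ → ℕ
  shannonColours D = D + ⌊ D /2⌋

  ≤-shannonColours : ∀ D → D ≤ shannonColours D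
  ≤-shannonColours D = m≤m+n D ⌊ D /2⌋

  3D≤1+2·shannonColours : ∀ D → 3 * D ≤ suc (2 * shannonColours D)
  3D≤1+2·shannonColours D = begin
    3 * D                            ≡⟨ trans (three D) (cong (2 * D +_) (sym (⌊n/2⌋+⌈n/2⌉≡n D))) ⟩
    2 * D + (⌊ D /2⌋ + ⌈ D /2⌉)       ≤⟨ +-monoʳ-≤ (2 * D) (+-monoʳ-≤ ⌊ D /2⌋ (⌊n/2⌋-mono (n≤1+n (suc D)))) ⟩
    2 * D + (⌊ D /2⌋ + suc ⌊ D /2⌋)   ≡⟨ merge D ⌊ D /2⌋ ⟩
    suc (2 * (D + ⌊ D /2⌋))           ∎
    where
    three : ∀ d → 3 * d ≡ 2 * d + d
    three = solve-∀
    merge : ∀ d h → 2 * d + (h + suc h) ≡ suc (2 * (d + h))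
    merge = solve-∀

  2·shannonColours≤3D : ∀ D → 2 * shannonColours D ≤ 3 * D
  2·shannonColours≤3D D = begin
    2 * (D + ⌊ D /2⌋)            ≡⟨ double D ⌊ D /2⌋ ⟩
    2 * D + (⌊ D /2⌋ + ⌊ D /2⌋)   ≤⟨ +-monoʳ-≤ (2 * D) (+-monoʳ-≤ ⌊ D /2⌋ (⌊n/2⌋≤⌈n/2⌉ D)) ⟩
    2 * D + (⌊ D /2⌋ + ⌈ D /2⌉)   ≡⟨ trans (cong (2 * D +_) (⌊n/2⌋+⌈n/2⌉≡n D)) (sym (three D)) ⟩
    3 * D                        ∎
    where
    double : ∀ d h → 2 * (d + h) ≡ 2 * d + (h + h)
    double = solve-∀
    three : ∀ d → 3 * d ≡ 2 * d + d
    three = solve-∀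

open ColourCount

module FunctionUpdate where

  open import Data.Vec.Functional using (updateAt)
  open import Data.Vec.Functional.Properties using (updateAt-updates; updateAt-minimal)
  open import Function.Base using (const)
  open import Relation.Binary.PropositionalEquality using (_≡_; _≢_)

  infixl 5 _[_]≔_

  _[_]≔_ : ∀ {A : Set} {n} → (Fin n → A) → Fin n → A → Fin n → A
  xs [ i ]≔ x = updateAt xs i (const x)

  []≔-updates : ∀ {A : Set} {n} (xs : Fin n → A) i {x} → (xs [ i ]≔ x) i ≡ x
  []≔-updates xs i = updateAt-updates i xs

  []≔-minimal : ∀ {A : Set} {n} {xs : Fin n → A} {i x j} → j ≢ i → (xs [ i ]≔ x) j ≡ xs j
  []≔-minimal {xs = xs} {i} {j = j} = updateAt-minimal j i xs

open FunctionUpdate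

module Fractions where

  open import Data.Bool.Base using (Bool; true; false; if_then_else_)
  import Data.Fin.Base as Fin
  open import Data.Integer.Base as ℤ using (+_; +≤+; +<+)
  import Data.Integer.Properties as ℤ
  open import Data.Integer.Tactic.RingSolver using (solve-∀)
  import Data.List.Base as List
  open import Data.Nat.Base using (zero; suc; _+_; _*_; _≤_; _<_)
  open import Data.Rational.Base using (_/_; 0ℚ; toℚᵘ)
    renaming (_+_ to _+ℚ_; _*_ to _*ℚ_; _≤_ to _≤ℚ_; _<_ to _<ℚ_)
  open import Data.Rational.Properties
    using (0/n≡0; toℚᵘ-fromℚᵘ; toℚᵘ-cancel-≤; toℚᵘ-cancel-<; toℚᵘ-injective; toℚᵘ-homo-+; toℚᵘ-homo-*)
  open import Data.Rational.Unnormalised.Base as ℚᵘ using (mkℚᵘ; *≡*; *≤*; *<*; _≃_)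
  import Data.Rational.Unnormalised.Properties as ℚᵘ
  open import Function.Base using (_∘_)
  open import Relation.Binary.PropositionalEquality

  -- Denominators are written suc r: then + a / suc r is definitionally fromℚᵘ (mkℚᵘ (+ a) r).
  toℚᵘ-/ : ∀ a r → toℚᵘ (+ a / suc r) ≃ mkℚᵘ (+ a) r
  toℚᵘ-/ a r = toℚᵘ-fromℚᵘ (mkℚᵘ (+ a) r)

  /-mono-≤ : ∀ {a b r s} → a * suc s ≤ b * suc r → + a / suc r ≤ℚ + b / suc s
  /-mono-≤ {a} {b} {r} {s} le = toℚᵘ-cancel-≤
    (ℚᵘ.≤-respˡ-≃ (ℚᵘ.≃-sym (toℚᵘ-/ a r)) (ℚᵘ.≤-respʳ-≃ (ℚᵘ.≃-sym (toℚᵘ-/ b s))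
      (*≤* (subst₂ ℤ._≤_ (ℤ.pos-* a (suc s)) (ℤ.pos-* b (suc r)) (+≤+ le)))))

  /-mono-< : ∀ {a b r s} → a * suc s < b * suc r → + a / suc r <ℚ + b / suc s
  /-mono-< {a} {b} {r} {s} lt = toℚᵘ-cancel-<
    (ℚᵘ.<-respˡ-≃ (ℚᵘ.≃-sym (toℚᵘ-/ a r)) (ℚᵘ.<-respʳ-≃ (ℚᵘ.≃-sym (toℚᵘ-/ b s))
      (*<* (subst₂ ℤ._<_ (ℤ.pos-* a (suc s)) (ℤ.pos-* b (suc r)) (+<+ lt)))))

  /-+ : ∀ a b r → + a / suc r +ℚ + b / suc r ≡ + (a + b) / suc r
  /-+ a b r = toℚᵘ-injective (ℚᵘ.≃-trans (toℚᵘ-homo-+ (+ a / suc r) (+ b / suc r))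
    (ℚᵘ.≃-trans (ℚᵘ.+-cong (toℚᵘ-/ a r) (toℚᵘ-/ b r)) (ℚᵘ.≃-trans sum-≃ (ℚᵘ.≃-sym (toℚᵘ-/ (a + b) r)))))
    where
    R = suc r
    sum-≃ : mkℚᵘ (+ a) r ℚᵘ.+ mkℚᵘ (+ b) r ≃ mkℚᵘ (+ (a + b)) r
    sum-≃ = *≡* (trans (factor (+ a) (+ b) (+ R)) (cong₂ ℤ._*_ (sym (ℤ.pos-+ a b)) (sym (ℤ.pos-* R R))))
      where
      factor : ∀ x y z → (x ℤ.* z ℤ.+ y ℤ.* z) ℤ.* z ≡ (x ℤ.+ y) ℤ.* (z ℤ.* z)
      factor = solve-∀

  /-* : ∀ a b r s → (+ a / suc r) *ℚ (+ b / suc s) ≡ + (a * b) / (suc r * suc s)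
  /-* a b r s = toℚᵘ-injective (ℚᵘ.≃-trans (toℚᵘ-homo-* (+ a / suc r) (+ b / suc s))
    (ℚᵘ.≃-trans (ℚᵘ.*-cong (toℚᵘ-/ a r) (toℚᵘ-/ b s))
      (ℚᵘ.≃-trans (ℚᵘ.≃-reflexive (cong (λ n → mkℚᵘ n _) (sym (ℤ.pos-* a b)))) (ℚᵘ.≃-sym (toℚᵘ-fromℚᵘ _)))))

  sumℚ-indicator : ∀ {n} r (b : Fin n → Bool) →
                   sumℚ (List.tabulate (λ j → if b j then + 1 / suc r else 0ℚ)) ≡ + (∑[ j < n ] toℕ (b j)) / suc r
  sumℚ-indicator {zero}  r b = sym (0/n≡0 (suc r))
  sumℚ-indicator {suc n} r b =
    trans (cong₂ _+ℚ_ (indicator (b Fin.zero)) (sumℚ-indicator r (b ∘ Fin.suc))) (/-+ (toℕ (b Fin.zero)) _ r)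
    where
    indicator : ∀ x → (if x then + 1 / suc r else 0ℚ) ≡ + toℕ x / suc r
    indicator true  = refl
    indicator false = sym (0/n≡0 (suc r))

module Graph (G : SimpleGraph) where

  open import Data.Bool.Base using (Bool; true; false; if_then_else_)
  open import Data.Bool.Properties using () renaming (_≟_ to _≟ᵇ_)
  open import Data.Fin.Properties using (_≟_; any?)
  open import Data.Nat.Base using (_+_; _*_; _≤_; z≤n)
  open import Data.Nat.Properties using (+-identityʳ; 1+n≢0; ≤-trans; ≤-reflexive)
  open import Data.Product using (∃-syntax; _×_; _,_; proj₁; proj₂)
  open import Data.Sum using (_⊎_; inj₁; inj₂)
  open import Function.Base using (_∘_)
  open import Relation.Binary.PropositionalEquality
  open import Relation.Nullary using (¬_; Dec; yes; no; does; contradiction)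
  open import Relation.Nullary.Decidable using (_⊎-dec_; _×-dec_; dec-true; dec-false)

  V : Set
  V = Fin (n G)

  E : Set
  E = Fin (m G)

  end₁ end₂ : E → V
  end₁ e = proj₁ (ends G e)
  end₂ e = proj₂ (ends G e)

  Incident : V → E → Set
  Incident v e = end₁ e ≡ v ⊎ end₂ e ≡ v

  incident? : ∀ v e → Dec (Incident v e)
  incident? v e = (end₁ e ≟ v) ⊎-dec (end₂ e ≟ v)

  Incident⇒incident : ∀ {v e} → Incident v e → incident G v e ≡ true
  Incident⇒incident {v} {e} = dec-true (incident? v e)

  other : E → V → V
  other e v = if does (end₁ e ≟ v) then end₂ e else end₁ e

  other-incident : ∀ e v → Incident (other e v) e
  other-incident e v with end₁ e ≟ v
  ... | yes _ = inj₂ refl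
  ... | no  _ = inj₁ refl

  other-≢ : ∀ {e v} → Incident v e → other e v ≢ v
  other-≢ {e} {v} v∈e with end₁ e ≟ v | v∈e
  ... | yes e₁≡v | _        = λ e₂≡v → loopless G e (trans e₁≡v (sym e₂≡v))
  ... | no  e₁≢v | inj₁ e₁≡v = contradiction e₁≡v e₁≢v
  ... | no  _    | inj₂ e₂≡v = λ e₁≡v → loopless G e (trans e₁≡v (sym e₂≡v))

  incident-cases : ∀ {e v w} → Incident v e → Incident w e → w ≡ v ⊎ w ≡ other e v
  incident-cases {e} {v} v∈e w∈e with end₁ e ≟ v | v∈e | w∈e
  ... | yes e₁≡v | _         | inj₁ e₁≡w = inj₁ (trans (sym e₁≡w) e₁≡v)
  ... | yes _    | _         | inj₂ e₂≡w = inj₂ (sym e₂≡w)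
  ... | no  _    | _         | inj₁ e₁≡w = inj₂ (sym e₁≡w)
  ... | no  e₁≢v | inj₁ e₁≡v | inj₂ _    = contradiction e₁≡v e₁≢v
  ... | no  _    | inj₂ e₂≡v | inj₂ e₂≡w = inj₁ (trans (sym e₂≡w) e₂≡v)

  EdgeSet : Set
  EdgeSet = E → Bool

  Covers : EdgeSet → V → Set
  Covers A v = ∃[ e ] A e ≡ true × Incident v e

  covers? : ∀ A v → Dec (Covers A v)
  covers? A v = any? (λ e → (A e ≟ᵇ true) ×-dec incident? v e)

  uncovered⇒∉ : ∀ {A v f} → ¬ Covers A v → Incident v f → A f ≡ false
  uncovered⇒∉ {A} {f = f} ¬c v∈f with A f in Af
  ... | true  = contradiction (f , Af , v∈f) ¬c
  ... | false = refl

  deg : EdgeSet → V → ℕ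
  deg A v = toℕ (does (covers? A v))

  deg-covered : ∀ {A v} → Covers A v → deg A v ≡ 1
  deg-covered {A} {v} c = cong toℕ (dec-true (covers? A v) c)

  deg-uncovered : ∀ {A v} → ¬ Covers A v → deg A v ≡ 0
  deg-uncovered {A} {v} ¬c = cong toℕ (dec-false (covers? A v) ¬c)

  deg≡0⇒uncovered : ∀ {A v} → deg A v ≡ 0 → ¬ Covers A v
  deg≡0⇒uncovered d≡0 c = 1+n≢0 (trans (sym (deg-covered c)) d≡0)

  deg-cong : ∀ {A B v} → (Covers A v → Covers B v) → (Covers B v → Covers A v) → deg A v ≡ deg B v
  deg-cong {B = B} {v} A→B B→A with covers? B v
  ... | yes c  = deg-covered (B→A c)
  ... | no  ¬c = deg-uncovered (¬c ∘ A→B)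

  IsMatchingᵇ : EdgeSet → Set
  IsMatchingᵇ A = ∀ {v e f} → A e ≡ true → A f ≡ true → Incident v e → Incident v f → e ≡ f

  _⊆ᵇ_ : EdgeSet → EdgeSet → Set
  A ⊆ᵇ B = ∀ {e} → A e ≡ true → B e ≡ true

  Covers-mono : ∀ {A B v} → A ⊆ᵇ B → Covers A v → Covers B v
  Covers-mono A⊆B (e , Ae , v∈e) = e , A⊆B Ae , v∈e

  IsMatchingᵇ-anti : ∀ {A B} → A ⊆ᵇ B → IsMatchingᵇ B → IsMatchingᵇ A
  IsMatchingᵇ-anti A⊆B mB Ae Af = mB (A⊆B Ae) (A⊆B Af)

  Free : EdgeSet → E → Set
  Free A f = ∀ {v} → Incident v f → ¬ Covers A v

  free : ∀ {A f} → ¬ Covers A (end₁ f) → ¬ Covers A (end₂ f) → Free A f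
  free ¬c₁ _ (inj₁ refl) = ¬c₁
  free _ ¬c₂ (inj₂ refl) = ¬c₂

  free⇒∉ : ∀ {A f} → Free A f → A f ≡ false
  free⇒∉ fr = uncovered⇒∉ (fr (inj₁ refl)) (inj₁ refl)

  free-at : ∀ {A f v} → Incident v f → ¬ Covers A v → ¬ Covers A (other f v) → Free A f
  free-at v∈f ¬cv ¬cu w∈f with incident-cases v∈f w∈f
  ... | inj₁ refl = ¬cv
  ... | inj₂ refl = ¬cu

  ⊆-insert : ∀ {A f} → A ⊆ᵇ (A [ f ]≔ true)
  ⊆-insert {A} {f} {e} Ae with e ≟ f
  ... | yes refl = []≔-updates A e
  ... | no  e≢f  = trans ([]≔-minimal e≢f) Ae

  remove-⊆ : ∀ {A f} → (A [ f ]≔ false) ⊆ᵇ A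
  remove-⊆ {A} {f} {e} A′e with e ≟ f
  ... | yes refl = contradiction (trans (sym ([]≔-updates A e)) A′e) λ ()
  ... | no  e≢f  = trans (sym ([]≔-minimal e≢f)) A′e

  insert-matching : ∀ {A f} → IsMatchingᵇ A → Free A f → IsMatchingᵇ (A [ f ]≔ true)
  insert-matching {A} {f} mA fr {v} {e} {e′} Ae Ae′ v∈e v∈e′ with e ≟ f | e′ ≟ f
  ... | yes e≡f | yes e′≡f = trans e≡f (sym e′≡f)
  ... | yes refl | no e′≢f = contradiction (e′ , trans (sym ([]≔-minimal e′≢f)) Ae′ , v∈e′) (fr v∈e)
  ... | no e≢f  | yes refl = contradiction (e , trans (sym ([]≔-minimal e≢f)) Ae , v∈e) (fr v∈e′)
  ... | no e≢f  | no e′≢f  = mA (trans (sym ([]≔-minimal e≢f)) Ae) (trans (sym ([]≔-minimal e′≢f)) Ae′) v∈e v∈e′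

  remove-uncovers : ∀ {A f v} → IsMatchingᵇ A → A f ≡ true → Incident v f → ¬ Covers (A [ f ]≔ false) v
  remove-uncovers {A} {f} mA Af v∈f (e , A′e , v∈e) with mA (remove-⊆ A′e) Af v∈e v∈f
  ... | refl = contradiction (trans (sym ([]≔-updates A f)) A′e) λ ()

  δ : E → E → ℕ
  δ f e = toℕ (does (e ≟ f))

  toℕ-insert : ∀ {A f} → A f ≡ false → ∀ e → toℕ ((A [ f ]≔ true) e) ≡ toℕ (A e) + δ f e
  toℕ-insert {A} {f} Af e with e ≟ f
  ... | yes refl rewrite []≔-updates A e {true} | Af = refl
  ... | no  e≢f  = trans (cong toℕ ([]≔-minimal e≢f)) (sym (+-identityʳ _))

  toℕ-remove : ∀ {A f} → A f ≡ true → ∀ e → toℕ ((A [ f ]≔ false) e) + δ f e ≡ toℕ (A e)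
  toℕ-remove {A} {f} Af e with e ≟ f
  ... | yes refl rewrite []≔-updates A e {false} | Af = refl
  ... | no  e≢f  = trans (+-identityʳ _) (cong toℕ ([]≔-minimal e≢f))

  δ-refl : ∀ {e} → δ e e ≡ 1
  δ-refl {e} = cong toℕ (dec-true (e ≟ e) refl)

  ι : V → E → ℕ
  ι v f = toℕ (does (incident? v f))

  ι-incident : ∀ {v f} → Incident v f → ι v f ≡ 1
  ι-incident {v} {f} v∈f = cong toℕ (dec-true (incident? v f) v∈f)

  ι-far : ∀ {v f} → ¬ Incident v f → ι v f ≡ 0
  ι-far {v} {f} v∉f = cong toℕ (dec-false (incident? v f) v∉f)

  deg-far : ∀ {A f b v} → ¬ Incident v f → deg (A [ f ]≔ b) v ≡ deg A v
  deg-far {A} {f} {b} {v} v∉f = deg-cong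
    (λ (e , A′e , v∈e) → e , trans (sym ([]≔-minimal (≢f v∈e))) A′e , v∈e)
    (λ (e , Ae , v∈e) → e , trans ([]≔-minimal (≢f v∈e)) Ae , v∈e)
    where
    ≢f : ∀ {e} → Incident v e → e ≢ f
    ≢f v∈e refl = v∉f v∈e

  deg-insert : ∀ {A f} → Free A f → ∀ v → deg (A [ f ]≔ true) v ≡ deg A v + ι v f
  deg-insert {A} {f} fr v with incident? v f
  ... | yes v∈f = trans (deg-covered (f , []≔-updates A f , v∈f))
                        (sym (cong₂ _+_ (deg-uncovered (fr v∈f)) (ι-incident v∈f)))
  ... | no  v∉f = trans (deg-far v∉f) (sym (trans (cong (deg A v +_) (ι-far v∉f)) (+-identityʳ _)))

  deg-remove : ∀ {A f} → IsMatchingᵇ A → A f ≡ true → ∀ v → deg (A [ f ]≔ false) v + ι v f ≡ deg A v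
  deg-remove {A} {f} mA Af v with incident? v f
  ... | yes v∈f = trans (cong₂ _+_ (deg-uncovered (remove-uncovers mA Af v∈f)) (ι-incident v∈f))
                        (sym (deg-covered (f , Af , v∈f)))
  ... | no  v∉f = trans (cong (deg (A [ f ]≔ false) v +_) (ι-far v∉f)) (trans (+-identityʳ _) (deg-far v∉f))

  deg≤incidences : ∀ A v → deg A v ≤ ∑[ f < m G ] (toℕ (A f) * ι v f)
  deg≤incidences A v with covers? A v
  ... | no  _ = z≤n
  ... | yes (e , Ae , v∈e) = ≤-trans (≤-reflexive (sym one)) (≤-sum (λ f → toℕ (A f) * ι v f) e)
    where
    one : toℕ (A e) * ι v e ≡ 1
    one rewrite Ae | ι-incident v∈e = refl

  load : (E → ℕ) → V → ℕ
  load g v = ∑[ f < m G ] (if incident G v f then g f else 0)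

module KempeChains (G : SimpleGraph) where

  open Graph G
  open import Data.Bool.Base using (true; false)
  open import Data.Fin.Properties using (_≟_)
  open import Data.Nat.Base using (suc; _+_; _<_; s≤s⁻¹)
  open import Data.Nat.Properties
    using (≤-refl; ≤-reflexive; ≤-trans; <-≤-trans; +-comm; +-cancelʳ-≡; +-identityʳ; +-monoˡ-<; m+n≡0⇒m≡0; m+n≡0⇒n≡0)
  open import Data.Nat.Tactic.RingSolver using (solve-∀)
  open import Data.Product using (_×_; _,_; proj₁; proj₂)
  open import Data.Sum using (inj₁; inj₂)
  open import Relation.Binary.PropositionalEquality
  open import Relation.Nullary using (¬_; yes; no; contradiction)
  open ≡-Reasoning

  size : EdgeSet → ℕ
  size A = ∑[ e < m G ] toℕ (A e)

  size-remove : ∀ {A f} → A f ≡ true → size (A [ f ]≔ false) < size A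
  size-remove {A} {f} Af = ≤-reflexive (begin
    suc (size A′)        ≡⟨ +-comm 1 (size A′) ⟩
    size A′ + 1          ≡⟨ cong (λ b → size A′ + toℕ b) Af ⟨
    size A′ + toℕ (A f)  ≡⟨ sum-exchange f (λ e e≢f → cong toℕ ([]≔-minimal e≢f)) ⟩
    size A + toℕ (A′ f)  ≡⟨ cong (λ b → size A + toℕ b) ([]≔-updates A f) ⟩
    size A + 0           ≡⟨ +-identityʳ (size A) ⟩
    size A               ∎)
    where
    A′ = A [ f ]≔ false

  -- What exchanging A and B along the A/B-alternating path from z (a vertex missed by A) achieves;
  -- the path ends at end.
  record KempeSwap (A B : EdgeSet) (z : V) : Set where
    field
      A′ B′          : EdgeSet
      A′-matching    : IsMatchingᵇ A′
      B′-matching    : IsMatchingᵇ B′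
      mult-preserved : ∀ e → toℕ (A′ e) + toℕ (B′ e) ≡ toℕ (A e) + toℕ (B e)
      z∉B′           : ¬ Covers B′ z
      end            : V
      trivial-end    : ¬ Covers B z → end ≡ z
      deg-preserved  : ∀ v → deg A′ v + deg B′ v ≡ deg A v + deg B v
      deg-unchanged  : ∀ v → v ≢ z → v ≢ end → deg A′ v ≡ deg A v × deg B′ v ≡ deg B v

  unswapped : ∀ {A B z} → IsMatchingᵇ A → IsMatchingᵇ B → ¬ Covers B z → KempeSwap A B z
  unswapped {A} {B} {z} mA mB z∉B = record
    { A′ = A ; B′ = B ; A′-matching = mA ; B′-matching = mB ; mult-preserved = λ _ → refl
    ; z∉B′ = z∉B ; end = z ; trivial-end = λ _ → refl
    ; deg-preserved = λ _ → refl ; deg-unchanged = λ _ _ _ → refl , refl }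

  module _ {A B z f} (A-matching : IsMatchingᵇ A) (B-matching : IsMatchingᵇ B) (z∉A : ¬ Covers A z)
           (f∈B : B f ≡ true) (z∈f : Incident z f) where

    swap-step : KempeSwap (B [ f ]≔ false) A (other f z) → KempeSwap A B z
    swap-step R = record
      { A′ = Q [ f ]≔ true ; B′ = P
      ; A′-matching = insert-matching R.B′-matching f-free-in-Q ; B′-matching = R.A′-matching
      ; mult-preserved = λ e → recount (R.mult-preserved e) (toℕ-insert f∉Q e) (toℕ-remove f∈B e)
      ; z∉B′ = z∉P ; end = R.end ; trivial-end = λ z∉B → contradiction (f , f∈B , z∈f) z∉B
      ; deg-preserved = λ v → recount (R.deg-preserved v) (deg-insert f-free-in-Q v) (deg-remove B-matching f∈B v)
      ; deg-unchanged = unchanged }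
      where
      module R = KempeSwap R
      P = R.A′
      Q = R.B′
      u = other f z
      u∈f = other-incident f z
      B₀ = B [ f ]≔ false

      deg-z : deg P z + deg Q z ≡ 0
      deg-z = trans (R.deg-preserved z)
        (cong₂ _+_ (deg-uncovered (remove-uncovers B-matching f∈B z∈f)) (deg-uncovered z∉A))

      z∉P : ¬ Covers P z
      z∉P = deg≡0⇒uncovered (m+n≡0⇒m≡0 (deg P z) deg-z)

      f-free-in-Q : Free Q f
      f-free-in-Q = free-at z∈f (deg≡0⇒uncovered (m+n≡0⇒n≡0 (deg P z) deg-z)) R.z∉B′

      f∉Q : Q f ≡ false
      f∉Q = uncovered⇒∉ R.z∉B′ u∈f

      recount : ∀ {a b a′ b₀ p q i} → p + q ≡ b₀ + a → a′ ≡ q + i → b₀ + i ≡ b → a′ + p ≡ a + b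
      recount {a} {b} {a′} {b₀} {p} {q} {i} pq a′≡ b₀i = begin
        a′ + p        ≡⟨ cong (_+ p) a′≡ ⟩
        q + i + p     ≡⟨ rotate q i p ⟩
        p + q + i     ≡⟨ cong (_+ i) pq ⟩
        b₀ + a + i    ≡⟨ swap-front b₀ a i ⟩
        a + (b₀ + i)  ≡⟨ cong (a +_) b₀i ⟩
        a + b         ∎
        where
        rotate : ∀ x y w → x + y + w ≡ w + x + y
        rotate = solve-∀
        swap-front : ∀ x y w → x + y + w ≡ y + (x + w)
        swap-front = solve-∀

      unchanged : ∀ v → v ≢ z → v ≢ R.end → deg (Q [ f ]≔ true) v ≡ deg A v × deg P v ≡ deg B v
      unchanged v v≢z v≢end with v ≟ u
      ... | no v≢u = let r = R.deg-unchanged v v≢u v≢end in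
        trans (deg-far v∉f) (proj₂ r) , trans (proj₁ r) (deg-far v∉f)
        where
        v∉f : ¬ Incident v f
        v∉f v∈f with incident-cases z∈f v∈f
        ... | inj₁ v≡z = v≢z v≡z
        ... | inj₂ v≡u = v≢u v≡u
      ... | yes refl with covers? A u
      ...   | no u∉A = contradiction (sym (R.trivial-end u∉A)) v≢end
      ...   | yes u∈A = deg-covered (f , []≔-updates Q f , u∈f) , (begin
        deg P u                ≡⟨ +-identityʳ (deg P u) ⟨
        deg P u + 0            ≡⟨ cong (deg P u +_) (deg-uncovered R.z∉B′) ⟨
        deg P u + deg Q u      ≡⟨ R.deg-preserved u ⟩
        deg B₀ u + deg A u     ≡⟨ cong₂ _+_ (deg-uncovered (remove-uncovers B-matching f∈B u∈f)) (deg-covered u∈A) ⟩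
        1                      ≡⟨ deg-covered (f , f∈B , u∈f) ⟨
        deg B u                ∎)

  module _ {A B z} (K : KempeSwap A B z) where

    open KempeSwap K

    A′-misses-both : ∀ {x y} → x ≢ z → y ≢ z → x ≢ y → ¬ Covers A x → Covers A y → ¬ Covers B y →
                     Covers B′ y → ¬ Covers A′ x × ¬ Covers A′ y
    A′-misses-both {x} {y} x≢z y≢z x≢y x∉A y∈A y∉B y∈B′ with y ≟ end
    ... | no y≢end = contradiction y∈B′
          (deg≡0⇒uncovered (trans (proj₂ (deg-unchanged y y≢z y≢end)) (deg-uncovered y∉B)))
    ... | yes refl = x∉A′ , y∉A′
      where
      x∉A′ : ¬ Covers A′ x
      x∉A′ = deg≡0⇒uncovered (trans (proj₁ (deg-unchanged x x≢z x≢y)) (deg-uncovered x∉A))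
      y∉A′ : ¬ Covers A′ end
      y∉A′ = deg≡0⇒uncovered (+-cancelʳ-≡ 1 _ _ (begin
        deg A′ end + 1          ≡⟨ cong (deg A′ end +_) (deg-covered y∈B′) ⟨
        deg A′ end + deg B′ end ≡⟨ deg-preserved end ⟩
        deg A end + deg B end   ≡⟨ cong₂ _+_ (deg-covered y∈A) (deg-uncovered y∉B) ⟩
        1                       ∎))

  kempeSwap : ∀ {A B z} → IsMatchingᵇ A → IsMatchingᵇ B → ¬ Covers A z → KempeSwap A B z
  kempeSwap {A} {B} = go (suc (size A + size B)) ≤-refl
    where
    go : ∀ N {A B z} → size A + size B < N → IsMatchingᵇ A → IsMatchingᵇ B → ¬ Covers A z → KempeSwap A B z
    go (suc N) {A} {B} {z} bound mA mB z∉A with covers? B z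
    ... | no  z∉B = unswapped mA mB z∉B
    ... | yes (f , f∈B , z∈f) = swap-step mA mB z∉A f∈B z∈f
      (go N shrunk (IsMatchingᵇ-anti remove-⊆ mB) mA (remove-uncovers mB f∈B (other-incident f z)))
      where
      shrunk : size (B [ f ]≔ false) + size A < N
      shrunk = <-≤-trans (+-monoˡ-< (size A) (size-remove f∈B))
                         (≤-trans (≤-reflexive (+-comm (size B) (size A))) (s≤s⁻¹ bound))

module EdgeColourings (G : SimpleGraph) (k : ℕ) where

  open Graph G
  open import Data.Bool.Base using (true; false)
  open import Data.Fin.Properties using (_≟_)
  open import Data.Nat.Base using (_+_)
  open import Data.Nat.Properties using (+-cancelʳ-≡; +-assoc; +-comm)
  open import Data.Nat.Tactic.RingSolver using (solve-∀)
  open import Data.Product using (Σ; _×_; _,_)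
  open import Function.Base using (_∘_)
  open import Relation.Binary.PropositionalEquality
  open import Relation.Nullary using (¬_; yes; no)
  open ≡-Reasoning

  Colouring : Set
  Colouring = Fin k → EdgeSet

  Proper : Colouring → Set
  Proper M = ∀ j → IsMatchingᵇ (M j)

  multiplicity : Colouring → E → ℕ
  multiplicity M e = ∑[ j < k ] toℕ (M j e)

  colours : Colouring → V → ℕ
  colours M v = ∑[ j < k ] deg (M j) v

  ColouringOf : (E → ℕ) → Set
  ColouringOf t = Σ Colouring λ M → Proper M × ∀ f → multiplicity M f ≡ t f

  Extension : Colouring → E → Set
  Extension M e = Σ Colouring λ M′ → Proper M′ × ∀ f → multiplicity M′ f ≡ multiplicity M f + δ e f

  proper-[]≔ : ∀ {M A} j → Proper M → IsMatchingᵇ A → Proper (M [ j ]≔ A)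
  proper-[]≔ {M} {A} j proper mA i with i ≟ j
  ... | yes refl = subst IsMatchingᵇ (sym ([]≔-updates M j)) mA
  ... | no  i≢j  = subst IsMatchingᵇ (sym ([]≔-minimal i≢j)) (proper i)

  multiplicity-[]≔ : ∀ M j A e → multiplicity (M [ j ]≔ A) e + toℕ (M j e) ≡ multiplicity M e + toℕ (A e)
  multiplicity-[]≔ M j A e = trans
    (sum-exchange {F = λ i → toℕ (M i e)} {G = λ i → toℕ ((M [ j ]≔ A) i e)} j
                  (λ i i≢j → cong (λ (X : EdgeSet) → toℕ (X e)) ([]≔-minimal {xs = M} i≢j)))
    (cong (λ (X : EdgeSet) → multiplicity M e + toℕ (X e)) ([]≔-updates M j))

  recolour₁ : ∀ {M γ A} {d : E → ℕ} → (∀ f → toℕ (A f) ≡ toℕ (M γ f) + d f) →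
              ∀ f → multiplicity (M [ γ ]≔ A) f ≡ multiplicity M f + d f
  recolour₁ {M} {γ} {A} {d} counts f = +-cancelʳ-≡ (toℕ (M γ f)) _ _ (begin
    multiplicity (M [ γ ]≔ A) f + toℕ (M γ f)  ≡⟨ multiplicity-[]≔ M γ A f ⟩
    multiplicity M f + toℕ (A f)               ≡⟨ cong (multiplicity M f +_) (trans (counts f) (+-comm _ (d f))) ⟩
    multiplicity M f + (d f + toℕ (M γ f))     ≡⟨ +-assoc (multiplicity M f) (d f) _ ⟨
    multiplicity M f + d f + toℕ (M γ f)       ∎)

  recolour₂ : ∀ {M α β A B} {d : E → ℕ} → α ≢ β →
              (∀ f → toℕ (A f) + toℕ (B f) ≡ toℕ (M α f) + toℕ (M β f) + d f) →
              ∀ f → multiplicity (M [ α ]≔ A [ β ]≔ B) f ≡ multiplicity M f + d f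
  recolour₂ {M} {α} {β} {A} {B} {d} α≢β counts f = +-cancelʳ-≡ (b₀ + a₀) _ _ (begin
    c₂ + (b₀ + a₀)       ≡⟨ +-assoc c₂ b₀ a₀ ⟨
    c₂ + b₀ + a₀         ≡⟨ cong (_+ a₀) step₂ ⟩
    c₁ + b + a₀          ≡⟨ swap-last c₁ b a₀ ⟩
    c₁ + a₀ + b          ≡⟨ cong (_+ b) (multiplicity-[]≔ M α A f) ⟩
    c + a + b            ≡⟨ +-assoc c a b ⟩
    c + (a + b)          ≡⟨ cong (c +_) (counts f) ⟩
    c + (a₀ + b₀ + d f)  ≡⟨ regroup c a₀ b₀ (d f) ⟩
    c + d f + (b₀ + a₀)  ∎)
    where
    M₁ = M [ α ]≔ A
    c  = multiplicity M f
    c₁ = multiplicity M₁ f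
    c₂ = multiplicity (M₁ [ β ]≔ B) f
    a₀ = toℕ (M α f)
    b₀ = toℕ (M β f)
    a  = toℕ (A f)
    b  = toℕ (B f)
    step₂ : c₂ + b₀ ≡ c₁ + b
    step₂ = trans (cong (λ (X : EdgeSet) → c₂ + toℕ (X f)) (sym ([]≔-minimal {xs = M} (α≢β ∘ sym))))
                  (multiplicity-[]≔ M₁ β B f)
    swap-last : ∀ x y z → x + y + z ≡ x + z + y
    swap-last = solve-∀
    regroup : ∀ x y z w → x + (y + z + w) ≡ x + w + (z + y)
    regroup = solve-∀

  extension-cong : ∀ {M M′ e} → (∀ f → multiplicity M′ f ≡ multiplicity M f) → Extension M′ e → Extension M e
  extension-cong {e = e} same (M″ , proper , mult) = M″ , proper , λ f → trans (mult f) (cong (_+ δ e f) (same f))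

  add-edge : ∀ {M γ e} → Proper M → Free (M γ) e → Extension M e
  add-edge {M} {γ} {e} proper e-free =
    M [ γ ]≔ (M γ [ e ]≔ true) ,
    proper-[]≔ γ proper (insert-matching (proper γ) e-free) ,
    recolour₁ (toℕ-insert (free⇒∉ e-free))

  shift-edge : ∀ {M α β f e} → Proper M → α ≢ β → M α f ≡ true → Incident (end₂ e) f →
               ¬ Covers (M α) (end₁ e) → Free (M β) f → Extension M e
  shift-edge {M} {α} {β} {f} {e} proper α≢β f∈α y∈f x∉α f-free =
    M [ α ]≔ A′ [ β ]≔ B′ ,
    proper-[]≔ β (proper-[]≔ α proper (insert-matching (IsMatchingᵇ-anti remove-⊆ (proper α)) e-free))
                 (insert-matching (proper β) f-free) ,
    recolour₂ α≢β counts
    where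
    A₀ = M α [ f ]≔ false
    A′ = A₀ [ e ]≔ true
    B′ = M β [ f ]≔ true
    e-free : Free A₀ e
    e-free = free (x∉α ∘ Covers-mono remove-⊆) (remove-uncovers (proper α) f∈α y∈f)
    counts : ∀ h → toℕ (A′ h) + toℕ (B′ h) ≡ toℕ (M α h) + toℕ (M β h) + δ e h
    counts h = begin
      toℕ (A′ h) + toℕ (B′ h)                       ≡⟨ cong₂ _+_ (toℕ-insert (free⇒∉ e-free) h) (toℕ-insert (free⇒∉ f-free) h) ⟩
      toℕ (A₀ h) + δ e h + (toℕ (M β h) + δ f h)     ≡⟨ regroup (toℕ (A₀ h)) (δ e h) (toℕ (M β h)) (δ f h) ⟩
      toℕ (A₀ h) + δ f h + toℕ (M β h) + δ e h       ≡⟨ cong (λ a → a + toℕ (M β h) + δ e h) (toℕ-remove f∈α h) ⟩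
      toℕ (M α h) + toℕ (M β h) + δ e h             ∎
      where
      regroup : ∀ a i b j → a + i + (b + j) ≡ a + j + b + i
      regroup = solve-∀

module Shannon (G : SimpleGraph) (k : ℕ) (g : Fin (m G) → ℕ) (D : ℕ) (load≤D : ∀ v → Graph.load G g v ℕ.≤ D)
               (D≤k : D ℕ.≤ k) (3D≤2k+1 : 3 ℕ.* D ℕ.≤ ℕ.suc (2 ℕ.* k)) where

  open Graph G
  open KempeChains G
  open EdgeColourings G k
  open import Data.Bool.Base using (true; false; if_then_else_)
  open import Data.Empty using (⊥; ⊥-elim)
  open import Data.Fin.Properties using (any?; ¬∀⟶∃¬)
  open import Data.List.Base using ([]; _∷_)
  open import Data.Nat.Base using (suc; _+_; _*_; _≤_; _<_; z≤n; s≤s)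
  open import Data.Nat.Properties
    using (≤-reflexive; ≤-trans; <-≤-trans; ≤-<-trans; <-irrefl; n<1+n; m≤n+m; +-comm; +-suc; +-identityʳ; +-mono-≤;
           *-comm; *-identityʳ; *-zeroʳ; module ≤-Reasoning)
  open import Data.Nat.Tactic.RingSolver using (solve-∀)
  open import Data.Product using (∃-syntax; _×_; _,_; uncurry)
  open import Data.Sum using (inj₁; inj₂)
  open import Function.Base using (_∘_)
  open import Relation.Binary.PropositionalEquality
  open import Relation.Nullary using (¬_; Dec; yes; no)
  open import Relation.Nullary.Decidable using (¬?; _×-dec_; decidable-stable)

  Partial : Colouring → Set
  Partial M = ∀ f → multiplicity M f ≤ g f

  colours≤incidences : ∀ M v → colours M v ≤ ∑[ f < m G ] (multiplicity M f * ι v f)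
  colours≤incidences M v = begin
    colours M v                                     ≤⟨ sum-mono-≤ (λ j → deg≤incidences (M j) v) ⟩
    ∑[ j < k ] ∑[ f < m G ] (toℕ (M j f) * ι v f)   ≡⟨ ∑-comm (λ j f → toℕ (M j f) * ι v f) ⟩
    ∑[ f < m G ] ∑[ j < k ] (toℕ (M j f) * ι v f)   ≡⟨ sum-cong-≗ (λ f → *-distribʳ-sum (ι v f) (λ j → toℕ (M j f))) ⟨
    ∑[ f < m G ] (multiplicity M f * ι v f)          ∎
    where open ≤-Reasoning

  colours≤D : ∀ {M} → Partial M → ∀ v → colours M v ≤ D
  colours≤D {M} partial v = ≤-trans (colours≤incidences M v)
    (≤-trans (sum-mono-≤ (λ f → scaled-≤ (incident G v f) (partial f))) (load≤D v))

  colours<D : ∀ {M e v} → Partial M → multiplicity M e < g e → Incident v e → colours M v < D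
  colours<D {M} {e} {v} partial short v∈e = <-≤-trans (≤-<-trans (colours≤incidences M v)
    (sum-mono-<-at (λ f → scaled-≤ (incident G v f) (partial f)) e at-e)) (load≤D v)
    where
    at-e : multiplicity M e * ι v e < (if incident G v e then g e else 0)
    at-e rewrite Incident⇒incident v∈e = ≤-trans (s≤s (≤-reflexive (*-identityʳ _))) short

  missing-colour : ∀ {M v} → colours M v < k → ∃[ j ] ¬ Covers (M j) v
  missing-colour {M} {v} few = ¬∀⟶∃¬ k (λ j → Covers (M j) v) (λ j → covers? (M j) v) not-all
    where
    not-all : ¬ (∀ j → Covers (M j) v)
    not-all covered = <-irrefl (trans (sum-cong-≗ (deg-covered ∘ covered)) (trans (sum-const {k} 1) (*-identityʳ k))) few

  missing-at : ∀ {M e v} → Partial M → multiplicity M e < g e → Incident v e → ∃[ j ] ¬ Covers (M j) v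
  missing-at partial short v∈e = missing-colour (<-≤-trans (colours<D partial short v∈e) D≤k)

  Gap : EdgeSet → V → V → Set
  Gap A v w = ¬ Covers A v × ¬ Covers A w

  gap? : ∀ (M : Colouring) v w → Dec (∃[ j ] Gap (M j) v w)
  gap? M v w = any? (λ j → ¬? (covers? (M j) v) ×-dec ¬? (covers? (M j) w))

  no-gap⇒covers : ∀ {M : Colouring} {v w} → ¬ (∃[ j ] Gap (M j) v w) → ∀ {j} → ¬ Covers (M j) v → Covers (M j) w
  no-gap⇒covers {M} {v} {w} no-gap {j} v∉j = decidable-stable (covers? (M j) w) (λ w∉j → no-gap (j , v∉j , w∉j))

  two-of-three : ∀ A x y z → ¬ Gap A x y → ¬ Gap A z y → ¬ Gap A z x → 2 ≤ deg A x + deg A y + deg A z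
  two-of-three A x y z xy zy zx with covers? A x | covers? A y | covers? A z
  ... | yes _ | yes _  | _      = s≤s (s≤s z≤n)
  ... | yes _ | no  _  | yes _  = s≤s (s≤s z≤n)
  ... | no  _ | yes _  | yes _  = s≤s (s≤s z≤n)
  ... | yes _ | no  ¬y | no  ¬z = ⊥-elim (zy (¬z , ¬y))
  ... | no ¬x | yes _  | no  ¬z = ⊥-elim (zx (¬z , ¬x))
  ... | no ¬x | no  ¬y | _      = ⊥-elim (xy (¬x , ¬y))

  crowded : ∀ {M e} → Partial M → multiplicity M e < g e → ∀ z →
            (∀ j → 2 ≤ deg (M j) (end₁ e) + deg (M j) (end₂ e) + deg (M j) z) → ⊥
  crowded {M} {e} partial short z two = <-irrefl refl (begin-strict
    suc (2 * k)                ≡⟨ cong suc (*-comm 2 k) ⟩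
    suc (k * 2)                <⟨ n<1+n _ ⟩
    suc (suc (k * 2))          ≤⟨ s≤s (s≤s slots) ⟩
    suc (suc (cx + cy + cz))   ≡⟨ cong (_+ cz) (+-suc (suc cx) cy) ⟨
    suc cx + suc cy + cz       ≤⟨ +-mono-≤ (+-mono-≤ (colours<D partial short (inj₁ refl)) (colours<D partial short (inj₂ refl)))
                                           (colours≤D partial z) ⟩
    D + D + D                  ≡⟨ triple D ⟩
    3 * D                      ≤⟨ 3D≤2k+1 ⟩
    suc (2 * k)                ∎)
    where
    open ≤-Reasoning
    x = end₁ e
    y = end₂ e
    cx = colours M x
    cy = colours M y
    cz = colours M z
    triple : ∀ d → d + d + d ≡ 3 * d
    triple = solve-∀
    slots : k * 2 ≤ cx + cy + cz
    slots = begin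
      k * 2                                                   ≡⟨ sum-const {k} 2 ⟨
      ∑[ j < k ] 2                                            ≤⟨ sum-mono-≤ two ⟩
      ∑[ j < k ] (deg (M j) x + deg (M j) y + deg (M j) z)    ≡⟨ ∑-distrib-+ (λ j → deg (M j) x + deg (M j) y) (λ j → deg (M j) z) ⟩
      ∑[ j < k ] (deg (M j) x + deg (M j) y) + cz             ≡⟨ cong (_+ cz) (∑-distrib-+ (λ j → deg (M j) x) (λ j → deg (M j) y)) ⟩
      cx + cy + cz                                            ∎

  module _ {M : Colouring} {e α β fz} (proper : Proper M) (no-xy : ¬ (∃[ j ] Gap (M j) (end₁ e) (end₂ e)))
           (x∉α : ¬ Covers (M α) (end₁ e)) (fz∈α : M α fz ≡ true) (y∈fz : Incident (end₂ e) fz)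
           (y∉β : ¬ Covers (M β) (end₂ e)) where

    private
      x = end₁ e
      y = end₂ e
      z = other fz y

      y∈α : Covers (M α) y
      y∈α = fz , fz∈α , y∈fz

      z∈α : Covers (M α) z
      z∈α = fz , fz∈α , other-incident fz y

      α≢β : α ≢ β
      α≢β refl = y∉β y∈α

      x≢y : x ≢ y
      x≢y = loopless G e

      x≢z : x ≢ z
      x≢z x≡z = x∉α (subst (Covers (M α)) (sym x≡z) z∈α)

      y≢z : y ≢ z
      y≢z = other-≢ y∈fz ∘ sym

    via-kempe : ∀ {γ} → ¬ Covers (M γ) z → ¬ Covers (M γ) x → Extension M e
    via-kempe {γ} z∉γ x∉γ = extension-cong unchanged (fit (covers? K.B′ y))
      where
      y∈γ : Covers (M γ) y
      y∈γ = no-gap⇒covers no-xy x∉γ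
      γ≢β : γ ≢ β
      γ≢β refl = y∉β y∈γ
      α≢γ : α ≢ γ
      α≢γ refl = z∉γ z∈α
      K : KempeSwap (M γ) (M β) z
      K = kempeSwap (proper γ) (proper β) z∉γ
      module K = KempeSwap K
      M′ : Colouring
      M′ = M [ γ ]≔ K.A′ [ β ]≔ K.B′
      proper′ : Proper M′
      proper′ = proper-[]≔ β (proper-[]≔ γ proper K.A′-matching) K.B′-matching
      unchanged : ∀ f → multiplicity M′ f ≡ multiplicity M f
      unchanged f = trans (recolour₂ {d = λ _ → 0} γ≢β (λ h → trans (K.mult-preserved h) (sym (+-identityʳ _))) f)
                          (+-identityʳ _)
      M′α : M′ α ≡ M α
      M′α = trans ([]≔-minimal α≢β) ([]≔-minimal α≢γ)
      M′β : M′ β ≡ K.B′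
      M′β = []≔-updates (M [ γ ]≔ K.A′) β
      M′γ : M′ γ ≡ K.A′
      M′γ = trans ([]≔-minimal γ≢β) ([]≔-updates M γ)
      fit : Dec (Covers K.B′ y) → Extension M′ e
      fit (yes y∈B′) = add-edge {γ = γ} proper′ (subst (λ A → Free A e) (sym M′γ)
        (uncurry free (A′-misses-both K x≢z y≢z x≢y x∉γ y∈γ y∉β y∈B′)))
      fit (no y∉B′) = shift-edge proper′ α≢β (subst (λ A → A fz ≡ true) (sym M′α) fz∈α) y∈fz
        (subst (λ A → ¬ Covers A x) (sym M′α) x∉α) (subst (λ A → Free A fz) (sym M′β) (free-at y∈fz y∉B′ K.z∉B′))

    extend-fan : Partial M → multiplicity M e < g e → Extension M e
    extend-fan partial short with gap? M z y
    ... | yes (γ , z∉γ , y∉γ) = shift-edge proper α≢γ fz∈α y∈fz x∉α (free-at y∈fz y∉γ z∉γ)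
      where
      α≢γ : α ≢ γ
      α≢γ refl = y∉γ y∈α
    ... | no no-zy with gap? M z x
    ...   | yes (γ , z∉γ , x∉γ) = via-kempe z∉γ x∉γ
    ...   | no  no-zx = ⊥-elim (crowded partial short z λ j →
            two-of-three (M j) x y z (λ gap → no-xy (j , gap)) (λ gap → no-zy (j , gap)) (λ gap → no-zx (j , gap)))

  extend : ∀ {M e} → Proper M → Partial M → multiplicity M e < g e → Extension M e
  extend {M} {e} proper partial short with gap? M (end₁ e) (end₂ e)
  ... | yes (γ , x∉γ , y∉γ) = add-edge {γ = γ} proper (free x∉γ y∉γ)
  ... | no no-xy with missing-at partial short (inj₁ refl) | missing-at partial short (inj₂ refl)
  ...   | α , x∉α | β , y∉β with no-gap⇒covers no-xy x∉α
  ...     | fz , fz∈α , y∈fz = extend-fan proper no-xy x∉α fz∈α y∈fz y∉β partial short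

  colour-list : ∀ L → (∀ f → occurrences f L ≤ g f) → ColouringOf (λ f → occurrences f L)
  colour-list []      _    = (λ _ _ → false) , (λ _ ()) , λ _ → trans (sum-const {k} 0) (*-zeroʳ k)
  colour-list (e ∷ L) fits = add-copy (colour-list L (λ f → ≤-trans (m≤n+m _ (δ e f)) (fits f)))
    where
    add-copy : ColouringOf (λ f → occurrences f L) → ColouringOf (λ f → occurrences f (e ∷ L))
    add-copy (M , proper , mult) =
      let (M′ , proper′ , mult′) = extend proper partial short in
      M′ , proper′ , λ f → trans (mult′ f) (trans (cong (_+ δ e f) (mult f)) (+-comm _ (δ e f)))
      where
      partial : Partial M
      partial f = subst (_≤ g f) (sym (mult f)) (≤-trans (m≤n+m _ (δ e f)) (fits f))
      short : multiplicity M e < g e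
      short = subst (λ c → suc c ≤ g e) (sym (mult e)) (subst (λ d → d + occurrences e L ≤ g e) (δ-refl {e}) (fits e))

  shannon : ColouringOf g
  shannon =
    let (M , proper , mult) = colour-list (copies g) (λ f → ≤-reflexive (occurrences-copies g f)) in
    M , proper , λ f → trans (mult f) (occurrences-copies g f)

module MaximalMatchings (G : SimpleGraph) where

  open Graph G
  open import Data.Bool.Base using (true; false)
  open import Data.Empty using (⊥-elim)
  open import Data.Fin.Subset using (Subset; _∈_)
  open import Data.List.Base using (List; []; _∷_; allFin)
  open import Data.List.Membership.Propositional using () renaming (_∈_ to _∈ᴸ_)
  open import Data.List.Membership.Propositional.Properties using (∈-allFin)
  open import Data.List.Relation.Unary.Any using (here; there)
  open import Data.Product using (∃-syntax; _×_; _,_)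
  open import Data.Sum using (_⊎_; inj₁; inj₂)
  import Data.Sum as Sum
  open import Data.Vec.Base using (tabulate)
  open import Data.Vec.Properties using ([]=⇒lookup; lookup⇒[]=; lookup∘tabulate)
  open import Function.Base using (id; _∘_)
  open import Relation.Binary.PropositionalEquality
  open import Relation.Nullary using (¬_; Dec; yes; no; contradiction)
  open import Relation.Nullary.Decidable using (_⊎-dec_)

  Blocked : EdgeSet → E → Set
  Blocked A f = Covers A (end₁ f) ⊎ Covers A (end₂ f)

  blocked? : ∀ A f → Dec (Blocked A f)
  blocked? A f = covers? A (end₁ f) ⊎-dec covers? A (end₂ f)

  Blocked-mono : ∀ {A B f} → A ⊆ᵇ B → Blocked A f → Blocked B f
  Blocked-mono A⊆B = Sum.map (Covers-mono A⊆B) (Covers-mono A⊆B)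

  blocked⇒¬free : ∀ {A f} → Blocked A f → ¬ Free A f
  blocked⇒¬free (inj₁ c) f-free = f-free (inj₁ refl) c
  blocked⇒¬free (inj₂ c) f-free = f-free (inj₂ refl) c

  insert-if-free : E → EdgeSet → EdgeSet
  insert-if-free f A with blocked? A f
  ... | yes _ = A
  ... | no  _ = A [ f ]≔ true

  ⊆-insert-if-free : ∀ {A} f → A ⊆ᵇ insert-if-free f A
  ⊆-insert-if-free {A} f with blocked? A f
  ... | yes _ = id
  ... | no  _ = ⊆-insert

  insert-if-free-matching : ∀ {A} f → IsMatchingᵇ A → IsMatchingᵇ (insert-if-free f A)
  insert-if-free-matching {A} f mA with blocked? A f
  ... | yes _         = mA
  ... | no  unblocked = insert-matching mA (free (unblocked ∘ inj₁) (unblocked ∘ inj₂))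

  insert-if-free-blocks : ∀ A f → Blocked (insert-if-free f A) f
  insert-if-free-blocks A f with blocked? A f
  ... | yes blocked = blocked
  ... | no  _       = inj₁ (f , []≔-updates A f , inj₁ refl)

  greedy : List E → EdgeSet → EdgeSet
  greedy []      A = A
  greedy (f ∷ L) A = greedy L (insert-if-free f A)

  ⊆-greedy : ∀ L {A} → A ⊆ᵇ greedy L A
  ⊆-greedy []      = id
  ⊆-greedy (f ∷ L) = ⊆-greedy L ∘ ⊆-insert-if-free f

  greedy-matching : ∀ L {A} → IsMatchingᵇ A → IsMatchingᵇ (greedy L A)
  greedy-matching []      = id
  greedy-matching (f ∷ L) = greedy-matching L ∘ insert-if-free-matching f

  greedy-blocks : ∀ {L f} A → f ∈ᴸ L → Blocked (greedy L A) f
  greedy-blocks {f ∷ L} A (here refl) = Blocked-mono (⊆-greedy L) (insert-if-free-blocks A f)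
  greedy-blocks {g ∷ L} A (there f∈L) = greedy-blocks (insert-if-free g A) f∈L

  maximal-extension : EdgeSet → EdgeSet
  maximal-extension = greedy (allFin (m G))

  ⊆-maximal-extension : ∀ {A} → A ⊆ᵇ maximal-extension A
  ⊆-maximal-extension = ⊆-greedy (allFin (m G))

  toSubset : EdgeSet → Subset (m G)
  toSubset = tabulate

  ∈-toSubset⁻ : ∀ {A e} → e ∈ toSubset A → A e ≡ true
  ∈-toSubset⁻ {A} {e} e∈A = trans (sym (lookup∘tabulate A e)) ([]=⇒lookup e∈A)

  ∈-toSubset⁺ : ∀ {A e} → A e ≡ true → e ∈ toSubset A
  ∈-toSubset⁺ {A} {e} Ae = lookup⇒[]= e (toSubset A) (trans (lookup∘tabulate A e) Ae)

  share⇒common : ∀ {e f} → ShareEndpoint G e f → ∃[ v ] Incident v e × Incident v f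
  share⇒common {e} {f} (inj₁ p)               = end₁ f , inj₁ p , inj₁ refl
  share⇒common {e} {f} (inj₂ (inj₁ p))        = end₂ f , inj₁ p , inj₂ refl
  share⇒common {e} {f} (inj₂ (inj₂ (inj₁ p))) = end₁ f , inj₂ p , inj₁ refl
  share⇒common {e} {f} (inj₂ (inj₂ (inj₂ p))) = end₂ f , inj₂ p , inj₂ refl

  common⇒share : ∀ {v e f} → Incident v e → Incident v f → ShareEndpoint G e f
  common⇒share (inj₁ p) (inj₁ q) = inj₁ (trans p (sym q))
  common⇒share (inj₁ p) (inj₂ q) = inj₂ (inj₁ (trans p (sym q)))
  common⇒share (inj₂ p) (inj₁ q) = inj₂ (inj₂ (inj₁ (trans p (sym q))))
  common⇒share (inj₂ p) (inj₂ q) = inj₂ (inj₂ (inj₂ (trans p (sym q))))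

  toSubset-matching : ∀ {A} → IsMatchingᵇ A → IsMatching G (toSubset A)
  toSubset-matching mA e f e∈A f∈A e≢f share with share⇒common share
  ... | v , v∈e , v∈f = e≢f (mA (∈-toSubset⁻ e∈A) (∈-toSubset⁻ f∈A) v∈e v∈f)

  maximal-extension-maximal : ∀ {A} → IsMatchingᵇ A → IsMaximalMatching G (toSubset (maximal-extension A))
  maximal-extension-maximal {A} mA = toSubset-matching (greedy-matching (allFin (m G)) mA) , maximal
    where
    X = maximal-extension A
    maximal : ∀ M′ → IsMatching G M′ → toSubset X Data.Fin.Subset.⊆ M′ → M′ Data.Fin.Subset.⊆ toSubset X
    maximal M′ M′-matching X⊆M′ {f} f∈M′ with X f in Xf
    ... | true  = ∈-toSubset⁺ Xf
    ... | false = ⊥-elim (blocked⇒¬free (greedy-blocks A (∈-allFin f)) f-free)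
      where
      f-free : Free X f
      f-free v∈f (e , Xe , v∈e) = M′-matching e f (X⊆M′ (∈-toSubset⁺ Xe)) f∈M′ e≢f (common⇒share v∈e v∈f)
        where
        e≢f : e ≢ f
        e≢f refl = contradiction (trans (sym Xe) Xf) λ ()

module Feasibility (I : OPS) where

  open Graph (graph I)
  open MaximalMatchings (graph I)
  open Fractions
  open import Data.Bool.Base using (true; if_then_else_)
  open import Data.Empty using (⊥-elim)
  open import Data.Fin.Base using (zero; suc)
  open import Data.Fin.Subset using (Subset)
  import Data.Integer.Base as ℤ
  open import Data.List.Base using ([]; foldr; tabulate)
  open import Data.List.Membership.Propositional using (_∈_)
  open import Data.List.Membership.Propositional.Properties using (∈-allFin; ∈-map⁺)
  open import Data.List.Properties using (map-tabulate)
  open import Data.List.Relation.Unary.All using (All; [])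
  open import Data.List.Relation.Unary.All.Properties using (tabulate⁺)
  open import Data.List.Relation.Unary.Any using (here; there)
  open import Data.Nat.Base using (zero; suc; _+_; _*_; _≤_; _⊔_; z≤n; s≤s)
  open import Data.Nat.Properties using (≤-trans; ≤-reflexive; <-irrefl; m≤m⊔n; m≤n⊔m; *-mono-≤; *-identityʳ; *-comm)
  open import Data.Nat.Tactic.RingSolver using (solve-∀)
  open import Data.Product using (Σ; _×_; _,_; proj₁; proj₂)
  open import Data.Rational.Base as ℚ using (ℚ; _/_; 0ℚ; 1ℚ)
  import Data.Rational.Properties as ℚ
  open import Data.Vec.Base using (lookup)
  open import Data.Vec.Properties using (lookup∘tabulate)
  open import Function.Base using (id; _∘_)
  open import Relation.Binary.PropositionalEquality

  Feasible : ℚ → Assignment I → Set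
  Feasible h y =
    All (λ p → IsMaximalMatching (graph I) (proj₁ p) × (0ℚ ℚ.≤ proj₂ p) × (proj₂ p ℚ.≤ 1ℚ)) y
    × (totalWeight I y ℚ.≤ 1ℚ)
    × (∀ e → (0ℚ ℚ.< coverage I y e) × (ℕtoℚ (g I e) ℚ.≤ h ℚ.* coverage I y e))

  sumℕ-tabulate : ∀ {n} (F : Fin n → ℕ) → sumℕ (tabulate F) ≡ ∑[ i < n ] F i
  sumℕ-tabulate {zero}  F = refl
  sumℕ-tabulate {suc n} F = cong (F zero +_) (sumℕ-tabulate (F ∘ suc))

  ≤-foldr-⊔ : ∀ {x xs} → x ∈ xs → x ≤ foldr _⊔_ 0 xs
  ≤-foldr-⊔ (here refl)  = m≤m⊔n _ _
  ≤-foldr-⊔ (there x∈xs) = ≤-trans (≤-foldr-⊔ x∈xs) (m≤n⊔m _ _)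

  load≤Gstar : ∀ v → load (g I) v ≤ Gstar I
  load≤Gstar v = ≤-trans (≤-reflexive (sym (trans (cong sumℕ (map-tabulate id F)) (sumℕ-tabulate F))))
                         (≤-foldr-⊔ (∈-map⁺ (weightedDegree I) (∈-allFin v)))
    where
    F : E → ℕ
    F f = if incident (graph I) v f then g I f else 0

  module Uniform (k′ : ℕ) (X : Fin (suc k′) → EdgeSet) where

    w : ℚ
    w = ℤ.+ 1 / suc k′

    pair : Fin (suc k′) → Subset (m (graph I)) × ℚ
    pair j = toSubset (X j) , w

    y : Assignment I
    y = tabulate pair

    totalWeight≡ : totalWeight I y ≡ ℤ.+ (∑[ j < suc k′ ] 1) / suc k′
    totalWeight≡ = trans (cong sumℚ (map-tabulate pair proj₂)) (sumℚ-indicator {suc k′} k′ λ _ → true)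

    coverage≡ : ∀ e → coverage I y e ≡ ℤ.+ (∑[ j < suc k′ ] toℕ (X j e)) / suc k′
    coverage≡ e = begin
      coverage I y e                                                    ≡⟨ cong sumℚ (map-tabulate pair entry) ⟩
      sumℚ (tabulate λ j → if lookup (toSubset (X j)) e then w else 0ℚ)  ≡⟨ sumℚ-indicator k′ (λ j → lookup (toSubset (X j)) e) ⟩
      ℤ.+ (∑[ j < suc k′ ] toℕ (lookup (toSubset (X j)) e)) / suc k′     ≡⟨ cong (λ c → ℤ.+ c / suc k′) (sum-cong-≗ λ j →
                                                                             cong toℕ (lookup∘tabulate (X j) e)) ⟩
      ℤ.+ (∑[ j < suc k′ ] toℕ (X j e)) / suc k′                         ∎
      where
      open ≡-Reasoning
      entry : Subset (m (graph I)) × ℚ → ℚ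
      entry (S , weight) = if lookup S e then weight else 0ℚ

  uniform-assignment : ∀ k → EdgeColourings.ColouringOf (graph I) k (g I) → 2 * k ≤ 3 * Gstar I →
                       Σ (Assignment I) (Feasible ((ℤ.+ 3 / 2) ℚ.* ℕtoℚ (Gstar I)))
  uniform-assignment zero (_ , _ , mult) _ =
    [] , [] , /-mono-≤ {0} {1} {0} {0} z≤n , λ e → ⊥-elim (<-irrefl (mult e) (g-pos I e))
  uniform-assignment (suc k′) (M , proper , mult) 2k≤3D = y , weights , total , λ e → positive e , bounded e
    where
    open Uniform k′ (maximal-extension ∘ M)
    D = Gstar I

    weights : All (λ p → IsMaximalMatching (graph I) (proj₁ p) × (0ℚ ℚ.≤ proj₂ p) × (proj₂ p ℚ.≤ 1ℚ)) y
    weights = tabulate⁺ λ j →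
      maximal-extension-maximal (proper j) , /-mono-≤ {0} {1} {0} {k′} z≤n , /-mono-≤ {1} {1} {k′} {0} (s≤s z≤n)

    total : totalWeight I y ℚ.≤ 1ℚ
    total = subst (ℚ._≤ 1ℚ) (sym totalWeight≡) (/-mono-≤ {∑[ j < suc k′ ] 1} {1} {k′} {0} (≤-reflexive count))
      where
      count : (∑[ j < suc k′ ] 1) * 1 ≡ 1 * suc k′
      count = trans (*-identityʳ _) (trans (sum-const {suc k′} 1) (*-comm (suc k′) 1))

    c : Fin (m (graph I)) → ℕ
    c e = ∑[ j < suc k′ ] toℕ (maximal-extension (M j) e)

    g≤c : ∀ e → g I e ≤ c e
    g≤c e = subst (_≤ c e) (mult e) (sum-mono-≤ {F = λ j → toℕ (M j e)} λ j → toℕ-mono (⊆-maximal-extension {M j}))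

    positive : ∀ e → 0ℚ ℚ.< coverage I y e
    positive e = subst (0ℚ ℚ.<_) (sym (coverage≡ e))
      (/-mono-< {0} {c e} {0} {k′} (≤-trans (g-pos I e) (≤-trans (g≤c e) (≤-reflexive (sym (*-identityʳ (c e)))))))

    bounded : ∀ e → ℕtoℚ (g I e) ℚ.≤ ((ℤ.+ 3 / 2) ℚ.* ℕtoℚ D) ℚ.* coverage I y e
    bounded e = begin
      ℕtoℚ (g I e)                                   ≤⟨ /-mono-≤ {g I e} {3 * D * c e} {0} cross ⟩
      ℤ.+ (3 * D * c e) / (2 * 1 * suc k′)            ≡⟨ /-* (3 * D) (c e) 1 k′ ⟨
      (ℤ.+ (3 * D) / 2) ℚ.* (ℤ.+ c e / suc k′)        ≡⟨ cong₂ ℚ._*_ (/-* 3 D 1 0) (coverage≡ e) ⟨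
      ((ℤ.+ 3 / 2) ℚ.* ℕtoℚ D) ℚ.* coverage I y e    ∎
      where
      open ℚ.≤-Reasoning
      cross : g I e * (2 * 1 * suc k′) ≤ 3 * D * c e * 1
      cross = ≤-trans (*-mono-≤ (g≤c e) 2k≤3D) (≤-reflexive (rearrange (c e) D))
        where
        rearrange : ∀ x d → x * (3 * d) ≡ 3 * d * x * 1
        rearrange = solve-∀

open import Data.Nat using (ℕ)
open import Data.Integer using (+_)
open import Data.Fin using (Fin)
open import Data.List.Relation.Unary.All using (All)
open import Data.Product using (Σ; _×_; proj₁; proj₂)
open import Data.Rational using (ℚ; _≤_; _<_; _*_; _/_; 0ℚ; 1ℚ)

lemma5 : (I : OPS) →
  Σ (Assignment I) λ y →
    All (λ p → IsMaximalMatching (graph I) (proj₁ p) × (0ℚ ≤ proj₂ p) × (proj₂ p ≤ 1ℚ)) y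
    × (totalWeight I y ≤ 1ℚ)
    × (∀ (e : Fin (m (graph I))) →
         (0ℚ < coverage I y e)
         × (ℕtoℚ (g I e) ≤ ((+ 3 / 2) * ℕtoℚ (Gstar I)) * coverage I y e))
lemma5 I = uniform-assignment (shannonColours D) shannon (2·shannonColours≤3D D)
  where
  open Feasibility I
  D = Gstar I
  open Shannon (graph I) (shannonColours D) (g I) D load≤Gstar (≤-shannonColours D) (3D≤1+2·shannonColours D)
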